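{- Let $D$ be a $(2,2)$ digraph and $G=CCE(D)$. If $C$ is a cycle in $G$, then $D$ has no arc both of whose ends are vertices of $C$.
   Context: All graphs and digraphs are simple (no loops, no multiple arcs). In a digraph $D$, if $(u,x)$ is an arc then $x$ is a prey of $u$ and $u$ is a predator of $x$. The CCE graph $CCE(D)$ of $D$ is the graph on $V(D)$ in which distinct $u,v$ are adjacent iff they have a common prey and a common predator in $D$. A $(2,2)$ digraph is an acyclic digraph in which every vertex has indegree at most $2$ and outdegree at most $2$. -}

module Defs where

open import Data.Nat using (ℕ; suc; _≤_)
open import Data.Bool using (Bool; T)
open import Data.Fin using (Fin; zero; suc; inject₁; fromℕ)
open import Data.List using (length; filterᵇ)
open import Data.List using () renaming (allFin to allFinL)
open import Data.Product using (_×_; ∃)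
open import Data.Empty using (⊥)
open import Relation.Nullary using (¬_)
open import Relation.Binary.PropositionalEquality using (_≡_; _≢_)
open import Relation.Binary.Construct.Closure.Transitive using (TransClosure)
open import Function.Definitions using (Injective)

-- Multiple arcs are impossible
-- in this representation; loops are excluded by 'Loopless'.
record Digraph (n : ℕ) : Set where
  field
    arc : Fin n → Fin n → Bool

open Digraph public

Arc : ∀ {n} → Digraph n → Fin n → Fin n → Set
Arc D u x = T (arc D u x)

Loopless : ∀ {n} → Digraph n → Set
Loopless D = ∀ v → ¬ Arc D v v

-- number of preys / predators
outdeg : ∀ {n} → Digraph n → Fin n → ℕ
outdeg {n} D u = length (filterᵇ (λ x → arc D u x) (allFinL n))

indeg : ∀ {n} → Digraph n → Fin n → ℕ
indeg {n} D x = length (filterᵇ (λ u → arc D u x) (allFinL n))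

Acyclic : ∀ {n} → Digraph n → Set
Acyclic D = ∀ v → ¬ TransClosure (Arc D) v v

Is22 : ∀ {n} → Digraph n → Set
Is22 {n} D = Loopless D × Acyclic D
           × (∀ v → indeg D v ≤ 2) × (∀ v → outdeg D v ≤ 2)

CCEAdj : ∀ {n} → Digraph n → Fin n → Fin n → Set
CCEAdj D u v = u ≢ v
             × ∃ (λ x → Arc D u x × Arc D v x)
             × ∃ (λ z → Arc D z u × Arc D z v)

record Cycle {n : ℕ} (Adj : Fin n → Fin n → Set) : Set where
  field
    k      : ℕ
    k≥2    : 2 ≤ k
    vert   : Fin (suc k) → Fin n
    inj    : Injective _≡_ _≡_ vert
    step   : ∀ (i : Fin k) → Adj (vert (inject₁ i)) (vert (suc i))
    close  : Adj (vert (fromℕ k)) (vert zero)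

open Cycle public

-- If a vertex u of C has a prey on C, so does every CCE-neighbour w of u. Let v be that
-- prey. Being on C, v has two distinct CCE-neighbours b₁, b₂ on C; their common predators
-- with v are distinct (else that predator has three preys), so by indegree ≤ 2 the predator
-- u of v is one of them and u also preys on some bᵢ. Now u has the two preys v and bᵢ on C,
-- and by outdegree ≤ 2 the common prey of u and w is one of them. Spreading along C, every
-- vertex of C has a prey on C, and following preys inside the finite set C closes a
-- directed cycle, contradicting acyclicity.
module Submission where

open import Defs
open import Function using (_∘_)
open import Data.Nat using (ℕ; zero; suc; _≤_; _<_; s≤s; z≤n)
open import Data.Nat.Properties using (≤-trans; n<1+n; m≤n⇒m<n∨m≡n)
open import Data.Bool using (Bool; T)
open import Data.Fin using (Fin; zero; suc; inject₁; fromℕ; toℕ)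
open import Data.Fin.Properties using (_≟_; suc-injective; injective⇒≤; pigeonhole)
open import Data.Fin.Induction using (<-weakInduction)
open import Data.List using (List; length; filterᵇ; allFin)
open import Data.List.Membership.Propositional using (_∈_)
open import Data.List.Membership.Propositional.Properties using (∈-filter⁺; ∈-allFin)
open import Data.List.Membership.Setoid.Properties using (index-injective)
open import Data.Vec using (Vec; []; _∷_)
open import Data.Vec.Relation.Unary.All using (All; []; _∷_)
open import Data.Vec.Relation.Unary.All.Properties using (lookup⁺)
open import Data.Vec.Relation.Unary.AllPairs using ([]; _∷_)
open import Data.Vec.Relation.Unary.Unique.Propositional using (Unique)
open import Data.Vec.Relation.Unary.Unique.Propositional.Properties using (lookup-injective)
open import Data.Product using (_×_; _,_; ∃; ∃₂; proj₁; proj₂)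
open import Data.Sum as Sum using (_⊎_; inj₁; inj₂)
open import Relation.Nullary using (¬_; yes; no; contradiction)
open import Relation.Nullary.Negation using (contradiction₂)
open import Relation.Nullary.Decidable using (T?)
open import Relation.Binary.PropositionalEquality using (_≡_; _≢_; refl; sym; subst; setoid)
open import Relation.Binary.Construct.Closure.Transitive using (TransClosure; [_]; _∷ʳ_)

unique-members⇒≤length : ∀ {A : Set} {m} {xs : List A} {ys : Vec A m} →
                         Unique ys → All (_∈ xs) ys → m ≤ length xs
unique-members⇒≤length {A} {ys = ys} ys-unique ys⊆xs = injective⇒≤ λ {i} {j} eq →
  lookup-injective ys-unique i j
    (index-injective (setoid A) (lookup⁺ ys⊆xs i) (lookup⁺ ys⊆xs j) eq)

AtMostTwo : ∀ {n} → (Fin n → Set) → Set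
AtMostTwo P = ∀ {a b c} → P a → P b → P c → a ≢ b → c ≡ a ⊎ c ≡ b

count≤2⇒atMostTwo : ∀ {n} (q : Fin n → Bool) →
                    length (filterᵇ q (allFin n)) ≤ 2 → AtMostTwo (T ∘ q)
count≤2⇒atMostTwo q count≤2 {a} {b} {c} qa qb qc a≢b with c ≟ a | c ≟ b
... | yes c≡a | _       = inj₁ c≡a
... | no _    | yes c≡b = inj₂ c≡b
... | no c≢a  | no c≢b  = contradiction (≤-trans 3≤count count≤2) λ { (s≤s (s≤s ())) }
  where
  member : ∀ {x} → T (q x) → x ∈ filterᵇ q (allFin _)
  member qx = ∈-filter⁺ (T? ∘ q) (∈-allFin _) qx

  3≤count : 3 ≤ length (filterᵇ q (allFin _))
  3≤count = unique-members⇒≤length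
    ((a≢b ∷ (c≢a ∘ sym) ∷ []) ∷ ((c≢b ∘ sym) ∷ []) ∷ [] ∷ [])
    (member qa ∷ member qb ∷ member qc ∷ [])

data Last⊎Inject₁ {m} : Fin (suc m) → Set where
  last   : Last⊎Inject₁ (fromℕ m)
  inject : ∀ i → Last⊎Inject₁ (inject₁ i)

last⊎inject₁ : ∀ {m} (l : Fin (suc m)) → Last⊎Inject₁ l
last⊎inject₁ {zero}  zero    = last
last⊎inject₁ {suc m} zero    = inject zero
last⊎inject₁ {suc m} (suc l) with last⊎inject₁ l
... | last     = last
... | inject i = inject (suc i)

inject₁²≢suc² : ∀ {m} (i : Fin m) → inject₁ (inject₁ i) ≢ suc (suc i)
inject₁²≢suc² (suc i) eq = inject₁²≢suc² i (suc-injective eq)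

path-spread : ∀ {m} (P : Fin (suc m) → Set) →
  (∀ i → P (inject₁ i) → P (suc i)) → (∀ i → P (suc i) → P (inject₁ i)) →
  ∀ {j} → P j → ∀ l → P l
path-spread P forward backward {j} Pj = <-weakInduction P (reach-zero j Pj) forward
  where
  reach-zero : ∀ l → P l → P zero
  reach-zero = <-weakInduction (λ l → P l → P zero) (λ P₀ → P₀) (λ i back → back ∘ backward i)

successor-everywhere⇒cycle : ∀ {A : Set} {R : A → A → Set} {m} (f : Fin (suc m) → A) →
  (∀ i → ∃ λ j → R (f i) (f j)) → ∃ λ v → TransClosure R v v
successor-everywhere⇒cycle {R = R} {m} f next = close-walk (pigeonhole (n<1+n (suc m)) (walk ∘ toℕ))
  where
  walk : ℕ → Fin (suc m)
  walk zero    = zero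
  walk (suc t) = proj₁ (next (walk t))

  walk-path : ∀ {s t} → s < t → TransClosure R (f (walk s)) (f (walk t))
  walk-path {s} {suc t} (s≤s s≤t) with m≤n⇒m<n∨m≡n s≤t
  ... | inj₁ s<t  = walk-path s<t ∷ʳ proj₂ (next (walk t))
  ... | inj₂ refl = [ proj₂ (next (walk s)) ]

  close-walk : (∃₂ λ i j → toℕ i < toℕ j × walk (toℕ i) ≡ walk (toℕ j)) → ∃ λ v → TransClosure R v v
  close-walk (i , j , i<j , walk-i≡walk-j) =
    f (walk (toℕ i)) , subst (TransClosure R (f (walk (toℕ i))) ∘ f) (sym walk-i≡walk-j) (walk-path i<j)

MinDegree≥2 : ∀ {n} → (Fin n → Fin n → Set) → (Fin n → Set) → Set
MinDegree≥2 Adj S = ∀ {v} → S v →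
  ∃₂ λ b₁ b₂ → b₁ ≢ b₂ × (S b₁ × Adj v b₁) × (S b₂ × Adj v b₂)

OnCycle : ∀ {n} {Adj : Fin n → Fin n → Set} → Cycle Adj → Fin n → Set
OnCycle C x = ∃ λ l → vert C l ≡ x

module _ {n} {Adj : Fin n → Fin n → Set} (Adj-sym : ∀ {x y} → Adj x y → Adj y x) where

  cycle-neighbours : (C : Cycle Adj) → ∀ l →
    ∃₂ λ a b → a ≢ b × Adj (vert C l) (vert C a) × Adj (vert C l) (vert C b)
  cycle-neighbours record { k = suc (suc k) ; k≥2 = s≤s (s≤s z≤n) ; step = step ; close = close } l
    with last⊎inject₁ l
  ... | last = zero , inject₁ (fromℕ (suc k)) , (λ ()) , close , Adj-sym (step (fromℕ (suc k)))
  ... | inject zero = suc zero , fromℕ (suc (suc k)) , (λ ()) , step zero , Adj-sym close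
  ... | inject (suc i) =
    suc (suc i) , inject₁ (inject₁ i) , inject₁²≢suc² i ∘ sym , step (suc i) , Adj-sym (step (inject₁ i))

  cycle-minDegree≥2 : (C : Cycle Adj) → MinDegree≥2 Adj (OnCycle C)
  cycle-minDegree≥2 C (l , refl) with cycle-neighbours C l
  ... | a , b , a≢b , la , lb = vert C a , vert C b , a≢b ∘ inj C , ((a , refl) , la) , ((b , refl) , lb)

CCEAdj-sym : ∀ {n} {D : Digraph n} {u v} → CCEAdj D u v → CCEAdj D v u
CCEAdj-sym (u≢v , (x , ux , vx) , (z , zu , zv)) = u≢v ∘ sym , (x , vx , ux) , (z , zv , zu)

PreyIn : ∀ {n} → Digraph n → (Fin n → Set) → Fin n → Set
PreyIn D S u = ∃ λ x → S x × Arc D u x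

module _ {n} {D : Digraph n}
         (indeg≤2 : ∀ v → indeg D v ≤ 2) (outdeg≤2 : ∀ v → outdeg D v ≤ 2) where

  preys-atMostTwo : ∀ u → AtMostTwo (Arc D u)
  preys-atMostTwo u = count≤2⇒atMostTwo (arc D u) (outdeg≤2 u)

  predators-atMostTwo : ∀ x → AtMostTwo (λ z → Arc D z x)
  predators-atMostTwo x = count≤2⇒atMostTwo (λ z → arc D z x) (indeg≤2 x)

  predator-of-two-neighbours : ∀ {v b₁ b₂ z} → b₁ ≢ b₂ →
    CCEAdj D v b₁ → CCEAdj D v b₂ → Arc D z v → Arc D z b₁ ⊎ Arc D z b₂
  predator-of-two-neighbours b₁≢b₂ (v≢b₁ , _ , z₁ , z₁v , z₁b₁) (v≢b₂ , _ , z₂ , z₂v , z₂b₂) zv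
    = Sum.map (λ { refl → z₁b₁ }) (λ { refl → z₂b₂ }) (predators-atMostTwo _ z₁v z₂v zv z₁≢z₂)
    where
    z₁≢z₂ : z₁ ≢ z₂
    z₁≢z₂ refl = contradiction₂ (preys-atMostTwo z₁ z₁b₁ z₂b₂ z₁v b₁≢b₂) v≢b₁ v≢b₂

  another-prey-in : ∀ {S u v} → MinDegree≥2 (CCEAdj D) S → S v → Arc D u v →
    ∃ λ b → v ≢ b × S b × Arc D u b
  another-prey-in δ Sv uv with δ Sv
  ... | b₁ , b₂ , b₁≢b₂ , (Sb₁ , vb₁@(v≢b₁ , _)) , (Sb₂ , vb₂@(v≢b₂ , _))
      with predator-of-two-neighbours b₁≢b₂ vb₁ vb₂ uv
  ...   | inj₁ ub₁ = b₁ , v≢b₁ , Sb₁ , ub₁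
  ...   | inj₂ ub₂ = b₂ , v≢b₂ , Sb₂ , ub₂

  prey-spreads : ∀ {S u w} → MinDegree≥2 (CCEAdj D) S →
    CCEAdj D u w → PreyIn D S u → PreyIn D S w
  prey-spreads {S} δ (_ , (x , ux , wx) , _) (v , Sv , uv) = x , x∈S , wx
    where
    x∈S : S x
    x∈S with another-prey-in δ Sv uv
    ... | b , v≢b , Sb , ub with preys-atMostTwo _ uv ub ux v≢b
    ...   | inj₁ refl = Sv
    ...   | inj₂ refl = Sb

proposition4p5 : ∀ {n : ℕ} (D : Digraph n) → Is22 D → (C : Cycle (CCEAdj D)) → ∀ (i j : Fin (suc (k C))) → ¬ Arc D (vert C i) (vert C j)
proposition4p5 D (_ , acyclic , indeg≤2 , outdeg≤2) C i j i→j =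
  acyclic _ (proj₂ (successor-everywhere⇒cycle (vert C) successor))
  where
  S : Fin _ → Set
  S = OnCycle C

  spread : ∀ {u w} → CCEAdj D u w → PreyIn D S u → PreyIn D S w
  spread = prey-spreads indeg≤2 outdeg≤2 (cycle-minDegree≥2 CCEAdj-sym C)

  prey-on-cycle : ∀ l → PreyIn D S (vert C l)
  prey-on-cycle = path-spread (PreyIn D S ∘ vert C)
    (λ l → spread (step C l)) (λ l → spread (CCEAdj-sym {D = D} (step C l))) (vert C j , (j , refl) , i→j)

  successor : ∀ l → ∃ λ l′ → Arc D (vert C l) (vert C l′)
  successor l with prey-on-cycle l
  ... | _ , (l′ , refl) , arc = l′ , arc
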